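{- Let $S$ be a finite semigroup, let $n\in\mathbb{N}$, and let $\mathcal{P}$ be a partition of $S$ into $n$ parts. Then there exists $A\in\mathcal{P}$ such that $\operatorname{cov}\Delta(A)\leq n$; that is, there exists a subset $X\subseteq S$ with $|X|\leq n$ and $S=X^{ -1}\Delta(A)$.
   Context: For a semigroup $S$, $a\in S$ and $A,B\subseteq S$: $a^{ -1}B=\{x\in S: ax\in B\}$ and $A^{ -1}B=\bigcup_{a\in A}a^{ -1}B$. For $A\subseteq S$, $\Delta(A)=\{x\in S: xA\cap A\neq\emptyset\}$. For $D\subseteq S$ with $S^{ -1}D=S$, the covering number is $\operatorname{cov}D=\min\{|X|: X\subseteq S,\ S=X^{ -1}D\}$ (it is undefined if $S^{ -1}D\neq S$). -}

module Defs where

open import Data.Nat using (ℕ)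
open import Data.Fin using (Fin)
open import Data.Fin.Subset using (Subset; _∈_)
open import Data.Product using (∃; _×_)
open import Relation.Binary.PropositionalEquality using (_≡_)

-- A finite semigroup on the carrier Fin m (every finite semigroup is
-- isomorphic to one of this form).
record FinSemigroup (m : ℕ) : Set where
  field
    _∙_   : Fin m → Fin m → Fin m
    assoc : ∀ x y z → ((x ∙ y) ∙ z) ≡ (x ∙ (y ∙ z))

module _ {m : ℕ} (S : FinSemigroup m) where
  open FinSemigroup S

  Δ : (Fin m → Set) → Fin m → Set
  Δ A x = ∃ λ a → A a × A (x ∙ a)

  InvImage : Subset m → (Fin m → Set) → Fin m → Set
  InvImage X D s = ∃ λ x → x ∈ X × D (x ∙ s)

  Covers : Subset m → (Fin m → Set) → Set
  Covers X D = ∀ s → InvImage X D s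

-- The part of a partition (given by a surjective colouring c : S → Fin n)
-- with index i.
Part : {m n : ℕ} → (Fin m → Fin n) → Fin n → Fin m → Set
Part c i s = c s ≡ i

-- Let R = tS be a principal right ideal of least size. For u ∈ R we get uS = R, and some
-- power of u fixes R pointwise, so left multiplication by u is invertible on R. Put
-- B_i = R ∩ A_i and choose greedily F_i ⊆ R maximal such that the translates v B_i
-- (v ∈ F_i) are pairwise disjoint. If B_i ≠ ∅ and |F_i| ≤ n, maximality says that each
-- ts B_i meets some v B_i, so the elements v⁻¹ t (v ∈ F_i) cover S by Δ(A_i). Otherwise
-- every nonempty B_i has n + 1 pairwise disjoint translates v_{i,j} B_i, and
-- (j, r) ↦ (i, v_{i,j} r), where i is the colour of r, injects (n + 1) × R into n × R,
-- which is impossible as R ≠ ∅.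
module Submission where

open import Defs
open import Data.Nat using (ℕ; zero; suc; _+_; _*_; _≤_; _<_; z≤n; s≤s; _≤?_)
open import Data.Nat.Properties
  using (+-suc; +-comm; +-identityʳ; ≤-trans; ≤-reflexive; m≤n⇒m≤1+n; <⇒≱; ≰⇒>;
         n<1+n; <-irrefl; *-cancelʳ-≤; m≤n⇒∃[o]m+o≡n; module ≤-Reasoning)
open import Data.Fin using (Fin; zero; suc; toℕ; _≟_; inject≤; combine; remQuot)
open import Data.Fin.Properties
  using (any?; pigeonhole; injective⇒≤; suc-injective; inject≤-injective; combine-remQuot; remQuot-combine)
open import Data.Fin.Subset using (Subset; inside; outside; _∈_; _⊆_; ∣_∣; ⁅_⁆; _∪_; ⋃)
open import Data.Fin.Subset.Properties
  using (_∈?_; p⊂q⇒∣p∣<∣q∣; ∣⁅x⁆∣≡1; ∣⊥∣≡0; x∈⁅x⁆; x∈⁅y⁆⇒x≡y; x∈p∪q⁺; x∈p∪q⁻; ∉⊥)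
open import Data.List using (List; []; _∷_; length; lookup; map; filter; allFin)
open import Data.List.Relation.Unary.All as All using ()
open import Data.List.Relation.Unary.All.Properties using (¬Any⇒All¬)
open import Data.List.Relation.Unary.AllPairs using (AllPairs; []; _∷_)
open import Data.List.Relation.Unary.Any as Any using (Any; here; there)
open import Data.List.Membership.Propositional using (find) renaming (_∈_ to _∈ₗ_)
open import Data.List.Membership.Propositional.Properties
  using (∈-allFin; ∈-lookup; ∈-filter⁺; ∈-filter⁻)
open import Data.List.Extrema.Nat using (argmin; f[argmin]≤f[xs])
open import Data.Vec.Base using ([]; _∷_; here; there)
open import Data.Empty using (⊥; ⊥-elim)
open import Data.Product using (∃; ∃₂; _×_; _,_; proj₁; proj₂; uncurry)
open import Data.Sum using (inj₁; inj₂)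
open import Function using (_∘_)
open import Level using (Level; 0ℓ)
open import Relation.Binary using (Rel; Decidable; Symmetric; Reflexive)
open import Relation.Nullary using (¬_; Dec; yes; no; contradiction; _×-dec_)
open import Relation.Binary.PropositionalEquality
  using (_≡_; _≢_; refl; sym; trans; cong; subst; module ≡-Reasoning)

private
  variable
    a ℓ : Level
    A : Set a
    k l n : ℕ

AllPairs-lookup : {R : Rel A ℓ} → Symmetric R → ∀ {xs} → AllPairs R xs →
                  ∀ {i j} → i ≢ j → R (lookup xs i) (lookup xs j)
AllPairs-lookup sym-R (_ ∷ _)  {zero}  {zero}  i≢j = contradiction refl i≢j
AllPairs-lookup sym-R (Rx ∷ _) {zero}  {suc j} _   = All.lookup Rx (∈-lookup j)
AllPairs-lookup sym-R (Rx ∷ _) {suc i} {zero}  _   = sym-R (All.lookup Rx (∈-lookup i))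
AllPairs-lookup sym-R (_ ∷ Rs) {suc i} {suc j} i≢j = AllPairs-lookup sym-R Rs (i≢j ∘ cong suc)

module Greedy {_~_ : Rel A ℓ} (_~?_ : Decidable _~_) where

  greedy : List A → List A
  greedy []       = []
  greedy (x ∷ xs) with Any.any? (x ~?_) (greedy xs)
  ... | yes _ = greedy xs
  ... | no  _ = x ∷ greedy xs

  greedy-⊆ : ∀ xs {y} → y ∈ₗ greedy xs → y ∈ₗ xs
  greedy-⊆ (x ∷ xs) y∈ with Any.any? (x ~?_) (greedy xs)
  greedy-⊆ (x ∷ xs) y∈          | yes _ = there (greedy-⊆ xs y∈)
  greedy-⊆ (x ∷ xs) (here y≡x)  | no  _ = here y≡x
  greedy-⊆ (x ∷ xs) (there y∈)  | no  _ = there (greedy-⊆ xs y∈)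

  greedy-apart : ∀ xs → AllPairs (λ x y → ¬ x ~ y) (greedy xs)
  greedy-apart []       = []
  greedy-apart (x ∷ xs) with Any.any? (x ~?_) (greedy xs)
  ... | yes _    = greedy-apart xs
  ... | no  ¬any = ¬Any⇒All¬ (greedy xs) ¬any ∷ greedy-apart xs

  greedy-dominates : Reflexive _~_ → ∀ xs {y} → y ∈ₗ xs → Any (y ~_) (greedy xs)
  greedy-dominates refl-~ (x ∷ xs) y∈ with Any.any? (x ~?_) (greedy xs)
  greedy-dominates refl-~ (x ∷ xs) (here refl) | yes any = any
  greedy-dominates refl-~ (x ∷ xs) (here refl) | no  _   = here refl-~
  greedy-dominates refl-~ (x ∷ xs) (there y∈)  | yes _   = greedy-dominates refl-~ xs y∈
  greedy-dominates refl-~ (x ∷ xs) (there y∈)  | no  _   = there (greedy-dominates refl-~ xs y∈)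

p⊆q∧∣q∣≤∣p∣⇒q⊆p : {p q : Subset n} → p ⊆ q → ∣ q ∣ ≤ ∣ p ∣ → q ⊆ p
p⊆q∧∣q∣≤∣p∣⇒q⊆p {p = p} p⊆q ∣q∣≤∣p∣ {x} x∈q with x ∈? p
... | yes x∈p = x∈p
... | no  x∉p = contradiction ∣q∣≤∣p∣ (<⇒≱ (p⊂q⇒∣p∣<∣q∣ (p⊆q , x , x∈q , x∉p)))

∣p∪q∣≤∣p∣+∣q∣ : (p q : Subset n) → ∣ p ∪ q ∣ ≤ ∣ p ∣ + ∣ q ∣
∣p∪q∣≤∣p∣+∣q∣ []            []            = z≤n
∣p∪q∣≤∣p∣+∣q∣ (inside  ∷ p) (inside  ∷ q) =
  s≤s (≤-trans (m≤n⇒m≤1+n (∣p∪q∣≤∣p∣+∣q∣ p q)) (≤-reflexive (sym (+-suc ∣ p ∣ ∣ q ∣))))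
∣p∪q∣≤∣p∣+∣q∣ (inside  ∷ p) (outside ∷ q) = s≤s (∣p∪q∣≤∣p∣+∣q∣ p q)
∣p∪q∣≤∣p∣+∣q∣ (outside ∷ p) (inside  ∷ q) =
  ≤-trans (s≤s (∣p∪q∣≤∣p∣+∣q∣ p q)) (≤-reflexive (sym (+-suc ∣ p ∣ ∣ q ∣)))
∣p∪q∣≤∣p∣+∣q∣ (outside ∷ p) (outside ∷ q) = ∣p∪q∣≤∣p∣+∣q∣ p q

image : (A → Fin n) → List A → Subset n
image f xs = ⋃ (map (⁅_⁆ ∘ f) xs)

∣image∣≤length : (f : A → Fin n) (xs : List A) → ∣ image f xs ∣ ≤ length xs
∣image∣≤length {n = n} f [] = ≤-reflexive (∣⊥∣≡0 n)
∣image∣≤length f (x ∷ xs) = begin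
  ∣ ⁅ f x ⁆ ∪ image f xs ∣       ≤⟨ ∣p∪q∣≤∣p∣+∣q∣ ⁅ f x ⁆ (image f xs) ⟩
  ∣ ⁅ f x ⁆ ∣ + ∣ image f xs ∣   ≡⟨ cong (_+ ∣ image f xs ∣) (∣⁅x⁆∣≡1 (f x)) ⟩
  suc ∣ image f xs ∣             ≤⟨ s≤s (∣image∣≤length f xs) ⟩
  suc (length xs)                ∎
  where open ≤-Reasoning

∈-image⁺ : (f : A → Fin n) {x : A} {xs : List A} → x ∈ₗ xs → f x ∈ image f xs
∈-image⁺ f (here refl) = x∈p∪q⁺ (inj₁ (x∈⁅x⁆ (f _)))
∈-image⁺ f (there x∈)  = x∈p∪q⁺ (inj₂ (∈-image⁺ f x∈))

∈-image⁻ : (f : A → Fin n) (xs : List A) {y : Fin n} → y ∈ image f xs →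
           ∃ λ x → x ∈ₗ xs × f x ≡ y
∈-image⁻ f []       y∈ = contradiction y∈ ∉⊥
∈-image⁻ f (x ∷ xs) y∈ with x∈p∪q⁻ ⁅ f x ⁆ (image f xs) y∈
... | inj₁ y∈⁅fx⁆ = x , here refl , sym (x∈⁅y⁆⇒x≡y (f x) y∈⁅fx⁆)
... | inj₂ y∈fxs with x′ , x′∈ , fx′≡y ← ∈-image⁻ f xs y∈fxs = x′ , there x′∈ , fx′≡y

element : (p : Subset n) → Fin ∣ p ∣ → Fin n
element (inside  ∷ p) zero    = zero
element (inside  ∷ p) (suc i) = suc (element p i)
element (outside ∷ p) i       = suc (element p i)

element∈ : (p : Subset n) (i : Fin ∣ p ∣) → element p i ∈ p
element∈ (inside  ∷ p) zero    = here
element∈ (inside  ∷ p) (suc i) = there (element∈ p i)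
element∈ (outside ∷ p) i       = there (element∈ p i)

element-injective : (p : Subset n) {i j : Fin ∣ p ∣} → element p i ≡ element p j → i ≡ j
element-injective (inside  ∷ p) {zero}  {zero}  _  = refl
element-injective (inside  ∷ p) {suc i} {suc j} eq =
  cong suc (element-injective p (suc-injective eq))
element-injective (outside ∷ p)                 eq =
  element-injective p (suc-injective eq)

position : {p : Subset n} {x : Fin n} → x ∈ p → Fin ∣ p ∣
position {p = inside  ∷ p} here       = zero
position {p = inside  ∷ p} (there x∈) = suc (position x∈)
position {p = outside ∷ p} (there x∈) = position x∈

element-position : {p : Subset n} {x : Fin n} (x∈p : x ∈ p) → element p (position x∈p) ≡ x
element-position {p = inside  ∷ p} here       = refl
element-position {p = inside  ∷ p} (there x∈) = cong suc (element-position x∈)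
element-position {p = outside ∷ p} (there x∈) = cong suc (element-position x∈)

position-injective : {p : Subset n} {x y : Fin n} (x∈p : x ∈ p) (y∈p : y ∈ p) →
                     position x∈p ≡ position y∈p → x ≡ y
position-injective {p = p} x∈p y∈p eq = begin
  _                        ≡⟨ sym (element-position x∈p) ⟩
  element p (position x∈p) ≡⟨ cong (element p) eq ⟩
  element p (position y∈p) ≡⟨ element-position y∈p ⟩
  _                        ∎
  where open ≡-Reasoning

×-injective⇒≤ : {m : ℕ} → Fin m → (f : Fin k × Fin m → Fin l × Fin m) →
                (∀ {x y} → f x ≡ f y → x ≡ y) → k ≤ l
×-injective⇒≤ {k} {l} {m = suc m′} _ f f-injective =
  *-cancelʳ-≤ k l (suc m′) (injective⇒≤ {f = f′} f′-injective)
  where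
  f′ : Fin (k * suc m′) → Fin (l * suc m′)
  f′ = uncurry combine ∘ f ∘ remQuot (suc m′)

  f′-injective : ∀ {x y} → f′ x ≡ f′ y → x ≡ y
  f′-injective {x} {y} eq = begin
    x                                         ≡˘⟨ combine-remQuot {k} (suc m′) x ⟩
    uncurry combine (remQuot {k} (suc m′) x)  ≡⟨ cong (uncurry combine) (f-injective f-eq) ⟩
    uncurry combine (remQuot {k} (suc m′) y)  ≡⟨ combine-remQuot {k} (suc m′) y ⟩
    y                                         ∎
    where
    open ≡-Reasoning
    f-eq : f (remQuot (suc m′) x) ≡ f (remQuot (suc m′) y)
    f-eq = begin
      f (remQuot (suc m′) x)             ≡˘⟨ remQuot-combine {l} _ _ ⟩
      remQuot (suc m′) (f′ x)            ≡⟨ cong (remQuot (suc m′)) eq ⟩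
      remQuot (suc m′) (f′ y)            ≡⟨ remQuot-combine {l} _ _ ⟩
      f (remQuot (suc m′) y)             ∎

module FinSemigroupProperties {m : ℕ} (S : FinSemigroup m) where
  open FinSemigroup S

  infix 30 _∙S
  _∙S : Fin m → Subset m
  u ∙S = image (u ∙_) (allFin m)

  ∙∈∙S : ∀ u s → u ∙ s ∈ u ∙S
  ∙∈∙S u s = ∈-image⁺ (u ∙_) (∈-allFin s)

  ∈∙S⁻ : ∀ {u x} → x ∈ u ∙S → ∃ λ s → u ∙ s ≡ x
  ∈∙S⁻ {u} x∈ with s , _ , us≡x ← ∈-image⁻ (u ∙_) (allFin m) x∈ = s , us≡x

  ∙S-rightIdeal : ∀ {u x} y → x ∈ u ∙S → x ∙ y ∈ u ∙S
  ∙S-rightIdeal {u} y x∈ with s , refl ← ∈∙S⁻ x∈ =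
    subst (_∈ u ∙S) (sym (assoc u s y)) (∙∈∙S u (s ∙ y))

  ∙S-mono : ∀ {u x} → x ∈ u ∙S → x ∙S ⊆ u ∙S
  ∙S-mono x∈ y∈ with w , refl ← ∈∙S⁻ y∈ = ∙S-rightIdeal w x∈

  ∃-min-∣∙S∣ : Fin m → ∃ λ t → ∀ u → ∣ t ∙S ∣ ≤ ∣ u ∙S ∣
  ∃-min-∣∙S∣ u₀ = t , λ u → All.lookup (f[argmin]≤f[xs] u₀ (allFin m)) (∈-allFin u)
    where t = argmin (∣_∣ ∘ _∙S) u₀ (allFin m)

  infixl 30 _^[1+_]
  _^[1+_] : Fin m → ℕ → Fin m
  u ^[1+ zero  ] = u
  u ^[1+ suc k ] = u ^[1+ k ] ∙ u

  ^-+ : ∀ u i j → u ^[1+ i ] ∙ u ^[1+ j ] ≡ u ^[1+ suc (i + j) ]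
  ^-+ u i zero    rewrite +-identityʳ i = refl
  ^-+ u i (suc j) rewrite +-suc i j =
    trans (sym (assoc (u ^[1+ i ]) (u ^[1+ j ]) u)) (cong (_∙ u) (^-+ u i j))

  ^-periodic : ∀ u → ∃₂ λ i d → u ^[1+ suc (d + i) ] ≡ u ^[1+ i ]
  ^-periodic u with i , j , i<j , uⁱ≡uʲ ← pigeonhole (n<1+n m) (λ k → u ^[1+ toℕ k ])
               with d , i+d≡j ← m≤n⇒∃[o]m+o≡n i<j =
    toℕ i , d , trans (cong (λ k → u ^[1+ suc k ]) (+-comm d (toℕ i)))
                      (trans (cong (u ^[1+_]) i+d≡j) (sym uⁱ≡uʲ))

  -- As u^(d+1) u^(i+1) = u^(i+1), the power e = u^(d+1) fixes u^(i+1) S pointwise, and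
  -- z = u^(2d+1) satisfies z u = e e.
  left-invertible : ∀ u → ∃₂ λ i z → ∀ {y} → y ∈ u ^[1+ i ] ∙S → z ∙ (u ∙ y) ≡ y
  left-invertible u with i , d , period ← ^-periodic u = i , u ^[1+ d + d ] , cancels
    where
    e = u ^[1+ d ]

    e-fixes : ∀ {y} → y ∈ u ^[1+ i ] ∙S → e ∙ y ≡ y
    e-fixes y∈ with w , refl ← ∈∙S⁻ y∈ = begin
      e ∙ (u ^[1+ i ] ∙ w)   ≡⟨ sym (assoc e (u ^[1+ i ]) w) ⟩
      (e ∙ u ^[1+ i ]) ∙ w   ≡⟨ cong (_∙ w) (trans (^-+ u d i) period) ⟩
      u ^[1+ i ] ∙ w         ∎
      where open ≡-Reasoning

    cancels : ∀ {y} → y ∈ u ^[1+ i ] ∙S → u ^[1+ d + d ] ∙ (u ∙ y) ≡ y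
    cancels {y} y∈ = begin
      u ^[1+ d + d ] ∙ (u ∙ y)  ≡⟨ sym (assoc (u ^[1+ d + d ]) u y) ⟩
      u ^[1+ suc (d + d) ] ∙ y  ≡˘⟨ cong (_∙ y) (^-+ u d d) ⟩
      (e ∙ e) ∙ y               ≡⟨ assoc e e y ⟩
      e ∙ (e ∙ y)               ≡⟨ cong (e ∙_) (e-fixes y∈) ⟩
      e ∙ y                     ≡⟨ e-fixes y∈ ⟩
      y                         ∎
      where open ≡-Reasoning

  leftInverse : Fin m → Fin m
  leftInverse u = proj₁ (proj₂ (left-invertible u))

  module MinimalRightIdeal (t : Fin m) (t-min : ∀ u → ∣ t ∙S ∣ ≤ ∣ u ∙S ∣) where

    R : Subset m
    R = t ∙S

    ∈R⇒R⊆∙S : ∀ {u} → u ∈ R → R ⊆ u ∙S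
    ∈R⇒R⊆∙S {u} u∈R = p⊆q∧∣q∣≤∣p∣⇒q⊆p (∙S-mono u∈R) (t-min u)

    ^-∈R : ∀ {u} k → u ∈ R → u ^[1+ k ] ∈ R
    ^-∈R zero    u∈R = u∈R
    ^-∈R (suc k) u∈R = ∙S-rightIdeal _ (^-∈R k u∈R)

    leftInverse-cancels : ∀ {u y} → u ∈ R → y ∈ R → leftInverse u ∙ (u ∙ y) ≡ y
    leftInverse-cancels {u} u∈R y∈R =
      proj₂ (proj₂ (left-invertible u)) (∈R⇒R⊆∙S (^-∈R (proj₁ (left-invertible u)) u∈R) y∈R)

    ∙-cancelˡ : ∀ {u y y′} → u ∈ R → y ∈ R → y′ ∈ R → u ∙ y ≡ u ∙ y′ → y ≡ y′
    ∙-cancelˡ {u} {y} {y′} u∈R y∈R y′∈R eq = begin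
      y                         ≡˘⟨ leftInverse-cancels u∈R y∈R ⟩
      leftInverse u ∙ (u ∙ y)   ≡⟨ cong (leftInverse u ∙_) eq ⟩
      leftInverse u ∙ (u ∙ y′)  ≡⟨ leftInverse-cancels u∈R y′∈R ⟩
      y′                        ∎
      where open ≡-Reasoning

    module Partition {n : ℕ} (c : Fin m → Fin n) where

      _∈B_ : Fin m → Fin n → Set
      x ∈B i = x ∈ R × c x ≡ i

      _∈B?_ : ∀ x i → Dec (x ∈B i)
      x ∈B? i = (x ∈? R) ×-dec (c x ≟ i)

      Meets : Fin n → Rel (Fin m) 0ℓ
      Meets i u v = ∃₂ λ b b′ → b ∈B i × b′ ∈B i × u ∙ b ≡ v ∙ b′

      meets? : ∀ i → Decidable (Meets i)
      meets? i u v = any? λ b → any? λ b′ → (b ∈B? i) ×-dec (b′ ∈B? i) ×-dec (u ∙ b ≟ v ∙ b′)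

      Meets-sym : ∀ {i} → Symmetric (Meets i)
      Meets-sym (b , b′ , b∈ , b′∈ , eq) = b′ , b , b′∈ , b∈ , sym eq

      Meets-refl : ∀ {i} → ∃ (_∈B i) → Reflexive (Meets i)
      Meets-refl (b , b∈) = b , b , b∈ , b∈ , refl

      elementsOfR : List (Fin m)
      elementsOfR = filter (_∈? R) (allFin m)

      private module G (i : Fin n) = Greedy (meets? i)

      family : Fin n → List (Fin m)
      family i = G.greedy i elementsOfR

      family⊆R : ∀ i {v} → v ∈ₗ family i → v ∈ R
      family⊆R i v∈ = proj₂ (∈-filter⁻ (_∈? R) {xs = allFin m} (G.greedy-⊆ i elementsOfR v∈))

      family-apart : ∀ i → AllPairs (λ u v → ¬ Meets i u v) (family i)
      family-apart i = G.greedy-apart i elementsOfR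

      family-dominates : ∀ {i u} → ∃ (_∈B i) → u ∈ R → Any (Meets i u) (family i)
      family-dominates {i} {u} B≠∅ u∈R =
        G.greedy-dominates i (Meets-refl B≠∅) elementsOfR (∈-filter⁺ (_∈? R) (∈-allFin u) u∈R)

      short-family-covers : ∀ {i} → ∃ (_∈B i) → length (family i) ≤ n →
                            ∃ λ X → ∣ X ∣ ≤ n × Covers S X (Δ S (Part c i))
      short-family-covers {i} B≠∅ short =
        image translate (family i) , ≤-trans (∣image∣≤length translate (family i)) short , covers
        where
        translate : Fin m → Fin m
        translate v = leftInverse v ∙ t

        covers : Covers S (image translate (family i)) (Δ S (Part c i))
        covers s with v , v∈ , b , b′ , (_ , cb≡i) , (b′∈R , cb′≡i) , tsb≡vb′
                        ← find (family-dominates B≠∅ (∙∈∙S t s)) =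
          translate v , ∈-image⁺ translate v∈ , b , cb≡i , subst (λ x → c x ≡ i) (sym lands) cb′≡i
          where
          lands : (translate v ∙ s) ∙ b ≡ b′
          lands = begin
            ((leftInverse v ∙ t) ∙ s) ∙ b  ≡⟨ cong (_∙ b) (assoc _ t s) ⟩
            (leftInverse v ∙ (t ∙ s)) ∙ b  ≡⟨ assoc _ _ b ⟩
            leftInverse v ∙ ((t ∙ s) ∙ b)  ≡⟨ cong (leftInverse v ∙_) tsb≡vb′ ⟩
            leftInverse v ∙ (v ∙ b′)       ≡⟨ leftInverse-cancels (family⊆R i v∈) b′∈R ⟩
            b′                             ∎
            where open ≡-Reasoning

      module _ (long : ∀ i → ∃ (_∈B i) → n < length (family i)) where

        -- The witness of B_i ≠ ∅ is irrelevant, so spread i does not depend on it.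
        spread : ∀ i → .(∃ (_∈B i)) → Fin (suc n) → Fin m
        spread i B≠∅ j = lookup (family i) (inject≤ j (long i B≠∅))

        spread-∈R : ∀ i .(B≠∅ : ∃ (_∈B i)) j → spread i B≠∅ j ∈ R
        spread-∈R i _ j = family⊆R i (∈-lookup _)

        spread-cancel : ∀ {i i′ r r′ j j′} .{B≠∅ : ∃ (_∈B i)} .{B′≠∅ : ∃ (_∈B i′)} →
                        i ≡ i′ → r ∈B i → r′ ∈B i′ →
                        spread i B≠∅ j ∙ r ≡ spread i′ B′≠∅ j′ ∙ r′ → j ≡ j′ × r ≡ r′
        spread-cancel {i} {j = j} {j′} {B≠∅} refl r∈ r′∈ eq with j ≟ j′
        ... | yes refl = refl , ∙-cancelˡ (spread-∈R i B≠∅ j) (proj₁ r∈) (proj₁ r′∈) eq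
        ... | no  j≢j′ = contradiction (_ , _ , r∈ , r′∈ , eq)
                           (AllPairs-lookup (λ ¬meets → ¬meets ∘ Meets-sym) (family-apart i)
                                            (j≢j′ ∘ inject≤-injective _ _ j j′))

        element∈B : ∀ a → element R a ∈B c (element R a)
        element∈B a = element∈ R a , refl

        colourAndTranslate : Fin (suc n) × Fin ∣ R ∣ → Fin n × Fin ∣ R ∣
        colourAndTranslate (j , a) =
          c r , position (∙S-rightIdeal r (spread-∈R (c r) (r , element∈B a) j))
          where r = element R a

        colourAndTranslate-injective : ∀ {p q} → colourAndTranslate p ≡ colourAndTranslate q → p ≡ q
        colourAndTranslate-injective {j , a} {j′ , a′} eq
          with refl , r≡r′ ← spread-cancel {j = j} {j′} {_ , element∈B a} {_ , element∈B a′}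
                               (cong proj₁ eq) (element∈B a) (element∈B a′)
                               (position-injective {p = R} _ _ (cong proj₂ eq))
          = cong (j ,_) (element-injective R r≡r′)

        families-not-all-long : ⊥
        families-not-all-long =
          <-irrefl refl (×-injective⇒≤ (position (∙∈∙S t t)) colourAndTranslate colourAndTranslate-injective)

      some-part-covers : ∃ λ i → ∃ λ X → ∣ X ∣ ≤ n × Covers S X (Δ S (Part c i))
      some-part-covers with any? (λ i → any? (_∈B? i) ×-dec (length (family i) ≤? n))
      ... | yes (i , B≠∅ , short) = i , short-family-covers B≠∅ short
      ... | no  ¬short = ⊥-elim (families-not-all-long λ i B≠∅ → ≰⇒> (¬short ∘ (i ,_) ∘ (B≠∅ ,_)))

theorem2 : (m : ℕ) → 0 < m → (S : FinSemigroup m) → (n : ℕ)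
    → (c : Fin m → Fin n) → (∀ i → ∃ λ s → c s ≡ i)
    → ∃ λ (i : Fin n) → ∃ λ (X : Subset m) → ∣ X ∣ ≤ n × Covers S X (Δ S (Part c i))
theorem2 (suc m) _ S n c _ =
  let t , t-min = ∃-min-∣∙S∣ zero in MinimalRightIdeal.Partition.some-part-covers t t-min c
  where open FinSemigroupProperties S
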